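{- Let $T$ be a finite decomposition semigroup. Define recursively $T_1=T$ and, for $n\geq1$: if $T_n$ has a neutral element $e_n$, set $T_{n+1}=T_n\setminus T_n^{\times}$, where $T_n^{\times}$ is the group of invertible elements of the monoid $T_n$; if $T_n$ has no neutral element, stop. Then for every $x\in T$ and every $n$ such that $T_n$ is defined and has a neutral element $e_n$, one has $$e_nxe_n=e_nx=xe_n\in T_n.$$
   Context: A semigroup $T$ is a finite decomposition semigroup if for every $t\in T$ the set of pairs $(t_1,t_2)\in T\times T$ with $t_1t_2=t$ is finite. -}

module Defs where

open import Level using (Level; _⊔_; Lift) renaming (suc to lsuc)
open import Algebra.Bundles using (Semigroup)
open import Data.Nat using (ℕ; suc)
open import Data.Unit using (⊤)
open import Data.Product using (_×_; ∃; proj₁; proj₂)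
open import Data.List using (List)
open import Data.List.Relation.Unary.Any using (Any)
open import Relation.Nullary using (¬_)

module _ {c ℓ : Level} (T : Semigroup c ℓ) where
  open Semigroup T

  -- For every t, the set of pairs (t₁ , t₂) with t₁ ∙ t₂ ≈ t is finite:
  -- it is covered (up to the semigroup equality ≈) by a finite list.
  FiniteDecomposition : Set (c ⊔ ℓ)
  FiniteDecomposition =
    ∀ t → ∃ λ (L : List (Carrier × Carrier)) →
      ∀ t₁ t₂ → t₁ ∙ t₂ ≈ t →
        Any (λ p → (t₁ ≈ proj₁ p) × (t₂ ≈ proj₂ p)) L

  Subset : Set (lsuc (c ⊔ ℓ))
  Subset = Carrier → Set (c ⊔ ℓ)

  IsNeutral : Subset → Carrier → Set (c ⊔ ℓ)
  IsNeutral S e = S e × (∀ x → S x → (e ∙ x ≈ x) × (x ∙ e ≈ x))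

  IsUnit : Subset → Carrier → Carrier → Set (c ⊔ ℓ)
  IsUnit S e u = S u × ∃ λ v → S v × (u ∙ v ≈ e) × (v ∙ u ≈ e)

  -- Stage n S : the recursion reaches step n and T_n = S.
  -- T_1 = T; if T_n has a neutral element e_n then T_{n+1} = T_n \ T_n^×.
  data Stage : ℕ → Subset → Set (lsuc (c ⊔ ℓ)) where
    first : Stage 1 (λ _ → Lift (c ⊔ ℓ) ⊤)
    next  : ∀ {n S e} → Stage n S → IsNeutral S e →
            Stage (suc n) (λ x → S x × ¬ IsUnit S e x)

-- Each e_n is central and satisfies e_n ∙ T ⊆ T_n; the invariant passes from e_n to
-- e_{n+1}. Since e_n is central and neutral on T_n, the idempotent e_{n+1} ∈ T_n
-- sends every x into T_n on either side, and e_{n+1} ∙ x, x ∙ e_{n+1} are never units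
-- of T_n: a one-sided inverse would force e_{n+1} = e_n. So both lie in T_{n+1}, where
-- e_{n+1} is neutral, and e_{n+1} ∙ x = e_{n+1} ∙ x ∙ e_{n+1} = x ∙ e_{n+1}.
module Submission where

open import Defs
open import Level using (Level; Lift; lift; _⊔_)
open import Algebra.Bundles using (Semigroup)
open import Data.Nat using (ℕ)
open import Data.Unit using (⊤; tt)
open import Data.Product using (_×_; _,_; proj₁; proj₂)
open import Relation.Binary.Definitions using (_Respects_)
open import Relation.Nullary using (¬_)
import Relation.Binary.Reasoning.Setoid as SetoidReasoning

module _ {c ℓ : Level} (T : Semigroup c ℓ) where
  open Semigroup T
  open SetoidReasoning setoid

  Whole : Subset T
  Whole _ = Lift (c ⊔ ℓ) ⊤

  NonUnits : Subset T → Carrier → Subset T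
  NonUnits S e x = S x × ¬ IsUnit T S e x

  CentralInto : Subset T → Carrier → Set (c ⊔ ℓ)
  CentralInto S e = ∀ x → (e ∙ x ≈ x ∙ e) × S (e ∙ x)

  isUnit-respects : ∀ {S e} → S Respects _≈_ → IsUnit T S e Respects _≈_
  isUnit-respects S-resp a≈b (Sa , v , Sv , av , va) =
    S-resp a≈b Sa , v , Sv , trans (∙-congʳ (sym a≈b)) av , trans (∙-congˡ (sym a≈b)) va

  stage-respects : ∀ {n S} → Stage T n S → S Respects _≈_
  stage-respects first          _   _          = lift tt
  stage-respects (next stage _) a≈b (Sa , ¬unit) =
    stage-respects stage a≈b Sa , λ unit → ¬unit (isUnit-respects (stage-respects stage) (sym a≈b) unit)

  idempotent-rightInvertible⇒≈ : ∀ {f e y v} → f ∙ f ≈ f → f ∙ e ≈ f → (f ∙ y) ∙ v ≈ e → f ≈ e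
  idempotent-rightInvertible⇒≈ {f} {e} {y} {v} ff fe fyv = begin
    f                 ≈⟨ sym fe ⟩
    f ∙ e             ≈⟨ ∙-congˡ (sym fyv) ⟩
    f ∙ ((f ∙ y) ∙ v) ≈⟨ sym (assoc f (f ∙ y) v) ⟩
    (f ∙ (f ∙ y)) ∙ v ≈⟨ ∙-congʳ (sym (assoc f f y)) ⟩
    ((f ∙ f) ∙ y) ∙ v ≈⟨ ∙-congʳ (∙-congʳ ff) ⟩
    (f ∙ y) ∙ v       ≈⟨ fyv ⟩
    e                 ∎

  idempotent-leftInvertible⇒≈ : ∀ {f e y v} → f ∙ f ≈ f → e ∙ f ≈ f → v ∙ (y ∙ f) ≈ e → f ≈ e
  idempotent-leftInvertible⇒≈ {f} {e} {y} {v} ff ef vyf = begin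
    f                 ≈⟨ sym ef ⟩
    e ∙ f             ≈⟨ ∙-congʳ (sym vyf) ⟩
    (v ∙ (y ∙ f)) ∙ f ≈⟨ assoc v (y ∙ f) f ⟩
    v ∙ ((y ∙ f) ∙ f) ≈⟨ ∙-congˡ (assoc y f f) ⟩
    v ∙ (y ∙ (f ∙ f)) ≈⟨ ∙-congˡ (∙-congˡ ff) ⟩
    v ∙ (y ∙ f)       ≈⟨ vyf ⟩
    e                 ∎

  neutral-absorbing⇒central : ∀ {S f} → IsNeutral T S f →
                              (∀ z → S (f ∙ z)) → (∀ z → S (z ∙ f)) → ∀ x → f ∙ x ≈ x ∙ f
  neutral-absorbing⇒central {f = f} (_ , f-neutral) fT⊆S Tf⊆S x = begin
    f ∙ x       ≈⟨ sym (proj₂ (f-neutral (f ∙ x) (fT⊆S x))) ⟩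
    (f ∙ x) ∙ f ≈⟨ assoc f x f ⟩
    f ∙ (x ∙ f) ≈⟨ proj₁ (f-neutral (x ∙ f) (Tf⊆S x)) ⟩
    x ∙ f       ∎

  centralInto-whole : ∀ {e} → IsNeutral T Whole e → CentralInto Whole e
  centralInto-whole (_ , e-neutral) x =
    trans (proj₁ (e-neutral x _)) (sym (proj₂ (e-neutral x _))) , lift tt

  centralInto-nonUnits : ∀ {S e f} → S Respects _≈_ → IsNeutral T S e → CentralInto S e →
                         IsNeutral T (NonUnits S e) f → CentralInto (NonUnits S e) f
  centralInto-nonUnits {S} {e} {f} S-resp (Se , e-neutral) e-central f-neutral@((Sf , f-nonUnit) , _) x =
    neutral-absorbing⇒central f-neutral fT⊆S Tf⊆S x , fT⊆S x
    where
    ef : e ∙ f ≈ f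
    ef = proj₁ (e-neutral f Sf)

    fe : f ∙ e ≈ f
    fe = proj₂ (e-neutral f Sf)

    ff : f ∙ f ≈ f
    ff = proj₁ (proj₂ f-neutral f (Sf , f-nonUnit))

    f≉e : ¬ f ≈ e
    f≉e f≈e = f-nonUnit (Sf , e , Se , trans fe f≈e , trans ef f≈e)

    fixed⇒∈ : ∀ {z} → e ∙ z ≈ z → S z
    fixed⇒∈ {z} ez≈z = S-resp ez≈z (proj₂ (e-central z))

    fT⊆S : ∀ z → NonUnits S e (f ∙ z)
    fT⊆S z = fixed⇒∈ (trans (sym (assoc e f z)) (∙-congʳ ef))
           , λ { (_ , _ , _ , fzv , _) → f≉e (idempotent-rightInvertible⇒≈ ff fe fzv) }

    Tf⊆S : ∀ z → NonUnits S e (z ∙ f)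
    Tf⊆S z = fixed⇒∈ ezf≈zf
           , λ { (_ , _ , _ , _ , vzf) → f≉e (idempotent-leftInvertible⇒≈ ff ef vzf) }
      where
      ezf≈zf : e ∙ (z ∙ f) ≈ z ∙ f
      ezf≈zf = begin
        e ∙ (z ∙ f) ≈⟨ proj₁ (e-central (z ∙ f)) ⟩
        (z ∙ f) ∙ e ≈⟨ assoc z f e ⟩
        z ∙ (f ∙ e) ≈⟨ ∙-congˡ fe ⟩
        z ∙ f       ∎

  stage-centralInto : ∀ {n S e} → Stage T n S → IsNeutral T S e → CentralInto S e
  stage-centralInto first                   = centralInto-whole
  stage-centralInto (next stage e-neutral) =
    centralInto-nonUnits (stage-respects stage) e-neutral (stage-centralInto stage e-neutral)

lemma2 : ∀ {c ℓ : Level} (T : Semigroup c ℓ) → FiniteDecomposition T →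
           ∀ (n : ℕ) (S : Subset T) (e : Semigroup.Carrier T) →
           Stage T n S → IsNeutral T S e →
           ∀ (x : Semigroup.Carrier T) →
           let open Semigroup T in
           ((e ∙ x) ∙ e ≈ e ∙ x) × (e ∙ x ≈ x ∙ e) × S (e ∙ x)
lemma2 T _ n S e stage e-neutral x with stage-centralInto T stage e-neutral x
... | ex≈xe , ex∈S = proj₂ (proj₂ e-neutral _ ex∈S) , ex≈xe , ex∈S
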